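{- Let $q\ge 7$. Then in the closure order $\preceq$ on $\mathbf W(q-2,2)$ the following relations hold: (1) for integers $j,i$ with $4\le j<q/2$ and $1\le i\le j-3$: $\gamma_{j+1,\,q+1-j+i}\preceq\gamma_{j,\,q+3-j+i}$; (2) for integers $j,i$ with $q/2+2<j\le q-1$ and $1\le i<j-q/2-1$: $\gamma_{q-j,\,j+1-i}\preceq\gamma_{q+2-j,\,j-i}$.
   Context: Permutations in $\mathfrak S_q$ are composed right to left; $(i,\dots,u)$ is the cycle $i\mapsto i+1\mapsto\cdots\mapsto u\mapsto i$. $\mathfrak S_q$ is a Coxeter group with simple reflections $s_i=(i,i+1)$, length $\ell$ = number of inversions, and Bruhat order $\le$ (the standard Bruhat order: $w'\le w$ iff there is a chain $w'=v_0,\dots,v_m=w$ with $\ell(v_{i-1})\le\ell(v_i)$ and each $v_{i-1}^{ -1}v_i$ a reflection). For $1\le u<v\le q$ let $\gamma_{u,v}=(2,3,\ldots,v)(1,2,\ldots,u)$; the set $\mathbf W(q-2,2)=\{\gamma_{u,v}:1\le u<v\le q\}$ is the set of minimal-length representatives of $W_J\backslash\mathfrak S_q$, where $J=\{s_1,\dots,s_{q-1}\}\setminus\{s_2\}$ and $W_J=\langle J\rangle$. Let $w_{0,J}$ be the longest element of $W_J$, i.e. the permutation swapping $1$ and $2$ and sending $x\mapsto q+3-x$ for $3\le x\le q$. The closure order on $\mathbf W(q-2,2)$ is defined by: $w\preceq w'$ iff there exists $h\in W_J$ with $$h\,w\,w_{0,J}\,h^{ -1}\,w_{0,J}\le w'$$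 in the Bruhat order of $\mathfrak S_q$. -}

module Defs where

open import Data.Nat using (ℕ; zero; suc; _+_; _∸_; _≤_; _<_; _<ᵇ_; _≡ᵇ_)
open import Data.Bool using (Bool; true; false; if_then_else_; _∧_; not)
open import Data.Product using (Σ; _×_; ∃; ∃-syntax)
open import Relation.Binary.PropositionalEquality using (_≡_; _≢_)

-- Permutations of {1,…,q} are represented as functions ℕ → ℕ (acting on
-- 1..q and fixing every other natural number).  Equality of permutations is
-- pointwise equality; composition is function composition (right to left).

Fun : Set
Fun = ℕ → ℕ

_≗_ : Fun → Fun → Set
f ≗ g = ∀ x → f x ≡ g x

idP : Fun
idP x = x

swap : ℕ → ℕ → Fun
swap a b x = if x ≡ᵇ a then b else (if x ≡ᵇ b then a else x)

-- the cycle (i, i+1, …, u) : i ↦ i+1 ↦ ⋯ ↦ u ↦ i  (identity if u ≤ i)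
cyc : ℕ → ℕ → Fun
cyc i u x = if (i <ᵇ suc x) ∧ (x <ᵇ u) then suc x
            else (if (x ≡ᵇ u) ∧ (i <ᵇ u) then i else x)

γ : ℕ → ℕ → Fun
γ u v x = cyc 2 v (cyc 1 u x)

-- number of inversions (Coxeter length) of σ ∈ 𝔖_q :
-- #{ (i,j) : 1 ≤ i < j ≤ q , σ i > σ j }
-- above σ y n = #{ i : 1 ≤ i ≤ n , σ i > y }
above : Fun → ℕ → ℕ → ℕ
above σ y zero = 0
above σ y (suc n) = above σ y n + (if y <ᵇ σ (suc n) then 1 else 0)

len : Fun → ℕ → ℕ
len σ zero = 0
len σ (suc n) = len σ n + above σ (σ (suc n)) n

-- Bruhat order on 𝔖_q, by the chain definition:
-- Bruhat q w' w  iff there is a chain w' = v₀, …, v_m = w with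
-- ℓ(v_{k-1}) ≤ ℓ(v_k) and v_{k-1}⁻¹ v_k a reflection, i.e. v_k = v_{k-1} (a b)
-- for a transposition (a b), 1 ≤ a < b ≤ q.
data Bruhat (q : ℕ) : Fun → Fun → Set where
  chain-base : ∀ {v w} → v ≗ w → Bruhat q v w
  chain-step : ∀ {v u w} (a b : ℕ) → 1 ≤ a → a < b → b ≤ q →
               (∀ x → w x ≡ u (swap a b x)) →
               len u q ≤ len w q →
               Bruhat q v u → Bruhat q v w

data InWJ (q : ℕ) : Fun → Set where
  wj-id   : ∀ {h} → h ≗ idP → InWJ q h
  wj-step : ∀ {h h'} (i : ℕ) → 1 ≤ i → suc i ≤ q → i ≢ 2 →
            (∀ x → h x ≡ h' (swap i (suc i) x)) →
            InWJ q h' → InWJ q h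

w0J : ℕ → Fun
w0J q x = if x ≡ᵇ 1 then 2 else
          (if x ≡ᵇ 2 then 1 else
          (if (2 <ᵇ x) ∧ (x <ᵇ suc q) then (q + 3) ∸ x else x))

Closure : ℕ → Fun → Fun → Set
Closure q w w' =
  Σ Fun λ h → Σ Fun λ hinv → (InWJ q h × (∀ x → h (hinv x) ≡ x) × (∀ x → hinv (h x) ≡ x) ×
    Bruhat q (λ x → h (w (w0J q (hinv (w0J q x))))) w')

module Submission where

-- Each relation w ⪯ w′ is witnessed by a single Bruhat step.  We exhibit h ∈ W_J, a product of
-- two cycles supported on {3,…,q}, and a transposition t = (a b) with h w w₀ h⁻¹ w₀ t = w′
-- (w₀ = w_{0,J}) and e(a) < e(b) for e = h w w₀ h⁻¹ w₀; right multiplication by such a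
-- transposition does not decrease the number of inversions, so e ≤ w′ in the Bruhat order.
--   (1)  h = (j+2, j+1, …, j−i+2)(q−j+2, …, q−j+3+i),   t = (q−j+1, q−j+3+i);
--   (2)  h = (q−j+2, …, q−j+3+i)(j+1, j, …, j−i+1),     t = (q−j, q−j+2).
-- The permutation identities are piecewise linear in the parameters; they are checked by evaluating
-- both sides symbolically on affine forms in the parameters, cutting the range of the argument into
-- intervals with affine end points and, where needed, splitting on small values of a parameter.

open import Defs
open import Data.Bool using (Bool; true; false; T; if_then_else_; _∧_)
open import Data.Bool.Properties using (∧-zeroʳ; T-≡)
open import Data.Empty using (⊥-elim)
open import Data.Fin using (Fin; zero; suc)
open import Data.List as List using (List; []; _∷_; _++_)
open import Data.Maybe as Maybe using (Maybe; just; nothing; from-just; _<∣>_; _>>=_)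
open import Data.Nat using (ℕ; zero; suc; pred; _+_; _*_; _∸_; _≤_; _<_; _<ᵇ_; _≡ᵇ_; _≤?_; _<?_;
                            _≤′_; ≤′-refl; ≤′-step; z≤n; s≤s)
open import Data.Nat.Properties
open import Data.Nat.Tactic.RingSolver using (solve-∀)
open import Data.Product using (Σ; _×_; _,_)
open import Data.Sum using (inj₁; inj₂)
open import Data.Vec as Vec using (Vec; []; _∷_; replicate; lookup; _[_]≔_)
open import Data.Vec.Properties using (lookup∘update; []≔-idempotent; []≔-lookup)
open import Data.Vec.Relation.Binary.Pointwise.Inductive as Pointwise using (Pointwise; []; _∷_)
open import Function using (_∘_)
open import Function.Bundles using (Equivalence)
open import Relation.Binary.PropositionalEquality hiding (_≗_)
open import Relation.Nullary using (¬_; yes; no)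
open import Relation.Nullary.Decidable using (dec⇒maybe)

private variable
  n : ℕ

<ᵇ-true : ∀ {m n} → m < n → (m <ᵇ n) ≡ true
<ᵇ-true = Equivalence.to T-≡ ∘ <⇒<ᵇ

<ᵇ-true⇒< : ∀ m n → (m <ᵇ n) ≡ true → m < n
<ᵇ-true⇒< m n = <ᵇ⇒< m n ∘ Equivalence.from T-≡

≡false : ∀ {b} → ¬ T b → b ≡ false
≡false {false} _  = refl
≡false {true}  ¬t = ⊥-elim (¬t _)

<ᵇ-false : ∀ {m n} → n ≤ m → (m <ᵇ n) ≡ false
<ᵇ-false n≤m = ≡false (λ m<n → <⇒≱ (<ᵇ⇒< _ _ m<n) n≤m)

≡ᵇ-refl : ∀ n → (n ≡ᵇ n) ≡ true
≡ᵇ-refl n = Equivalence.to T-≡ (≡⇒≡ᵇ n n refl)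

≡ᵇ-false : ∀ {m n} → m ≢ n → (m ≡ᵇ n) ≡ false
≡ᵇ-false m≢n = ≡false (m≢n ∘ ≡ᵇ⇒≡ _ _)

cyc-below : ∀ {i u y} → y < i → cyc i u y ≡ y
cyc-below {i} {u} {y} y<i rewrite <ᵇ-false {i} {suc y} y<i with y ≟ u
... | yes refl rewrite <ᵇ-false {i} {y} (<⇒≤ y<i) | ∧-zeroʳ (y ≡ᵇ y) = refl
... | no  y≢u  rewrite ≡ᵇ-false y≢u = refl

cyc-inside : ∀ {i u y} → i ≤ y → y < u → cyc i u y ≡ suc y
cyc-inside i≤y y<u rewrite <ᵇ-true (s≤s i≤y) | <ᵇ-true y<u = refl

cyc-top : ∀ {i u} → i < u → cyc i u u ≡ i
cyc-top {i} {u} i<u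
  rewrite <ᵇ-false {u} {u} ≤-refl | ∧-zeroʳ (i <ᵇ suc u) | ≡ᵇ-refl u | <ᵇ-true i<u = refl

cyc-above : ∀ {i u y} → u < y → cyc i u y ≡ y
cyc-above {i} {u} {y} u<y
  rewrite <ᵇ-false (<⇒≤ u<y) | ∧-zeroʳ (i <ᵇ suc y) | ≡ᵇ-false (>⇒≢ u<y) = refl

cyc-trivial : ∀ {i u y} → u ≤ i → cyc i u y ≡ y
cyc-trivial {i} {u} {y} u≤i rewrite <ᵇ-false u≤i | ∧-zeroʳ (y ≡ᵇ u) with i <? suc y
... | yes i<1+y rewrite <ᵇ-true i<1+y | <ᵇ-false (≤-trans u≤i (≤-pred i<1+y)) = refl
... | no  i≮1+y rewrite <ᵇ-false (≮⇒≥ i≮1+y) = refl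

cyc⁻¹ : ℕ → ℕ → Fun
cyc⁻¹ i u x = if (i <ᵇ x) ∧ (x <ᵇ suc u) then pred x
              else (if (x ≡ᵇ i) ∧ (i <ᵇ u) then u else x)

cyc⁻¹-below : ∀ {i u y} → y < i → cyc⁻¹ i u y ≡ y
cyc⁻¹-below {i} {u} {y} y<i rewrite <ᵇ-false {i} {y} (<⇒≤ y<i) | ≡ᵇ-false (<⇒≢ y<i) = refl

cyc⁻¹-bottom : ∀ {i u} → i < u → cyc⁻¹ i u i ≡ u
cyc⁻¹-bottom {i} {u} i<u rewrite <ᵇ-false {i} {i} ≤-refl | ≡ᵇ-refl i | <ᵇ-true i<u = refl

cyc⁻¹-inside : ∀ {i u y} → i ≤ y → y < u → cyc⁻¹ i u (suc y) ≡ y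
cyc⁻¹-inside i≤y y<u rewrite <ᵇ-true (s≤s i≤y) | <ᵇ-true (s≤s y<u) = refl

cyc⁻¹-above : ∀ {i u y} → u < y → cyc⁻¹ i u y ≡ y
cyc⁻¹-above {i} {u} {y} u<y rewrite <ᵇ-false {y} {suc u} u<y | ∧-zeroʳ (i <ᵇ y) with y ≟ i
... | yes refl rewrite <ᵇ-false (<⇒≤ u<y) | ∧-zeroʳ (y ≡ᵇ y) = refl
... | no  y≢i  rewrite ≡ᵇ-false y≢i = refl

cyc⁻¹-trivial : ∀ {i u y} → u ≤ i → cyc⁻¹ i u y ≡ y
cyc⁻¹-trivial {i} {u} {y} u≤i rewrite <ᵇ-false u≤i | ∧-zeroʳ (y ≡ᵇ i) with i <? y
... | yes i<y rewrite <ᵇ-true i<y | <ᵇ-false {y} {suc u} (≤-trans (s≤s u≤i) i<y) = refl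
... | no  i≮y rewrite <ᵇ-false (≮⇒≥ i≮y) = refl

swap-left : ∀ {a b} → swap a b a ≡ b
swap-left {a} rewrite ≡ᵇ-refl a = refl

swap-right : ∀ {a b} → b ≢ a → swap a b b ≡ a
swap-right {a} {b} b≢a rewrite ≡ᵇ-false b≢a | ≡ᵇ-refl b = refl

swap-other : ∀ {a b y} → y ≢ a → y ≢ b → swap a b y ≡ y
swap-other y≢a y≢b rewrite ≡ᵇ-false y≢a | ≡ᵇ-false y≢b = refl

w0J-middle : ∀ {q y z} → 3 ≤ y → y ≤ q → y + z ≡ 3 + q → w0J q y ≡ z
w0J-middle {q} {y@(suc (suc (suc _)))} {z} (s≤s (s≤s (s≤s _))) y≤q y+z≡3+q rewrite <ᵇ-true (s≤s y≤q) =
  trans (cong (_∸ y) (trans (+-comm q 3) (sym y+z≡3+q))) (m+n∸m≡n y z)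

w0J-above : ∀ {q y} → 3 ≤ y → q < y → w0J q y ≡ y
w0J-above {q} {y@(suc (suc (suc _)))} (s≤s (s≤s (s≤s _))) q<y rewrite <ᵇ-false {y} {suc q} q<y = refl

-- Affine forms in n parameters

data Form (n : ℕ) : Set where
  affine : ℕ → Vec ℕ n → Form n

Env : ℕ → Set
Env = Vec ℕ

lin : Vec ℕ n → Env n → ℕ
lin []       []      = 0
lin (c ∷ cs) (x ∷ ρ) = c * x + lin cs ρ

-- Forms are evaluated by adding one copy of a parameter at a time, from the left, so that a
-- closed form in concrete parameters m, i₀, g reduces to a plain sum such as 9 + m + m + i₀ + g.
add-copies : ℕ → ℕ → ℕ → ℕ
add-copies zero    x acc = acc
add-copies (suc c) x acc = add-copies c x (acc + x)

accumulate : ℕ → Vec ℕ n → Env n → ℕ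
accumulate acc []       []      = acc
accumulate acc (c ∷ cs) (x ∷ ρ) = accumulate (add-copies c x acc) cs ρ

⟦_⟧ : Form n → Env n → ℕ
⟦ affine c cs ⟧ ρ = accumulate c cs ρ

add-copies≡ : ∀ c x acc → add-copies c x acc ≡ acc + c * x
add-copies≡ zero    x acc = sym (+-identityʳ acc)
add-copies≡ (suc c) x acc = trans (add-copies≡ c x (acc + x)) (+-assoc acc x (c * x))

accumulate≡ : ∀ acc (cs : Vec ℕ n) ρ → accumulate acc cs ρ ≡ acc + lin cs ρ
accumulate≡ acc []       []      = sym (+-identityʳ acc)
accumulate≡ acc (c ∷ cs) (x ∷ ρ)
  rewrite accumulate≡ (add-copies c x acc) cs ρ | add-copies≡ c x acc = +-assoc acc (c * x) (lin cs ρ)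

infixr 5 _+ᶠ_
infixl 6 _⊕_
infixr 7 _⊛_

#_ : ℕ → Form n
# c = affine c (replicate _ 0)

var : Fin n → Form n
var v = affine 0 (replicate _ 0 [ v ]≔ 1)

_+ᶠ_ : ℕ → Form n → Form n
k +ᶠ affine c cs = affine (k + c) cs

_⊕_ : Form n → Form n → Form n
affine c cs ⊕ affine d ds = affine (c + d) (Vec.zipWith _+_ cs ds)

_⊛_ : ℕ → Form n → Form n
k ⊛ affine c cs = affine (k * c) (Vec.map (k *_) cs)

wk : Form n → Form (suc n)
wk (affine c cs) = affine c (0 ∷ cs)

_[_≔_]ᶠ : Form n → Fin n → Form n → Form n
affine c cs [ v ≔ E ]ᶠ = affine c (cs [ v ]≔ 0) ⊕ lookup cs v ⊛ E

+-interchange : ∀ a b c d → (a + b) + (c + d) ≡ (a + c) + (b + d)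
+-interchange = solve-∀

+-*-interchange : ∀ c d x s t → (c + d) * x + (s + t) ≡ (c * x + s) + (d * x + t)
+-*-interchange = solve-∀

lin-zero : (ρ : Env n) → lin (replicate n 0) ρ ≡ 0
lin-zero []      = refl
lin-zero (x ∷ ρ) = lin-zero ρ

lin-unit : (v : Fin n) (ρ : Env n) → lin (replicate n 0 [ v ]≔ 1) ρ ≡ lookup ρ v
lin-unit zero    (x ∷ ρ) = trans (cong₂ _+_ (*-identityˡ x) (lin-zero ρ)) (+-identityʳ x)
lin-unit (suc v) (x ∷ ρ) = lin-unit v ρ

lin-+ : (cs ds : Vec ℕ n) (ρ : Env n) → lin (Vec.zipWith _+_ cs ds) ρ ≡ lin cs ρ + lin ds ρ
lin-+ []       []       []      = refl
lin-+ (c ∷ cs) (d ∷ ds) (x ∷ ρ) rewrite lin-+ cs ds ρ = +-*-interchange c d x (lin cs ρ) (lin ds ρ)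

lin-* : (k : ℕ) (cs : Vec ℕ n) (ρ : Env n) → lin (Vec.map (k *_) cs) ρ ≡ k * lin cs ρ
lin-* k []       []      = sym (*-zeroʳ k)
lin-* k (c ∷ cs) (x ∷ ρ) rewrite lin-* k cs ρ = distribute k c x (lin cs ρ)
  where
  distribute : ∀ k c x s → k * c * x + k * s ≡ k * (c * x + s)
  distribute = solve-∀

lin-[]≔ : (cs : Vec ℕ n) (ρ : Env n) (v : Fin n) (t : ℕ) →
          lin cs (ρ [ v ]≔ t) ≡ lin (cs [ v ]≔ 0) ρ + lookup cs v * t
lin-[]≔ (c ∷ cs) (x ∷ ρ) zero    t = +-comm (c * t) (lin cs ρ)
lin-[]≔ (c ∷ cs) (x ∷ ρ) (suc v) t rewrite lin-[]≔ cs ρ v t = sym (+-assoc (c * x) _ _)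

lin-∸ : ∀ {cs ds : Vec ℕ n} → Pointwise _≤_ cs ds → (ρ : Env n) →
        lin ds ρ ≡ lin cs ρ + lin (Vec.zipWith _∸_ ds cs) ρ
lin-∸ []                         []      = refl
lin-∸ {cs = c ∷ cs} {d ∷ ds} (c≤d ∷ cs≤ds) (x ∷ ρ) = begin
  d * x + lin ds ρ
    ≡⟨ cong₂ (λ d s → d * x + s) (sym (m+[n∸m]≡n c≤d)) (lin-∸ cs≤ds ρ) ⟩
  (c + (d ∸ c)) * x + (lin cs ρ + lin (Vec.zipWith _∸_ ds cs) ρ)
    ≡⟨ +-*-interchange c (d ∸ c) x _ _ ⟩
  (c * x + lin cs ρ) + ((d ∸ c) * x + lin (Vec.zipWith _∸_ ds cs) ρ) ∎
  where open ≡-Reasoning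

⟦+ᶠ⟧ : (k : ℕ) (P : Form n) (ρ : Env n) → ⟦ k +ᶠ P ⟧ ρ ≡ k + ⟦ P ⟧ ρ
⟦+ᶠ⟧ k (affine c cs) ρ rewrite accumulate≡ (k + c) cs ρ | accumulate≡ c cs ρ = +-assoc k c _

⟦⊕⟧ : (P Q : Form n) (ρ : Env n) → ⟦ P ⊕ Q ⟧ ρ ≡ ⟦ P ⟧ ρ + ⟦ Q ⟧ ρ
⟦⊕⟧ (affine c cs) (affine d ds) ρ
  rewrite accumulate≡ (c + d) (Vec.zipWith _+_ cs ds) ρ | accumulate≡ c cs ρ | accumulate≡ d ds ρ
        | lin-+ cs ds ρ = +-interchange c d _ _

⟦⊛⟧ : (k : ℕ) (P : Form n) (ρ : Env n) → ⟦ k ⊛ P ⟧ ρ ≡ k * ⟦ P ⟧ ρ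
⟦⊛⟧ k (affine c cs) ρ
  rewrite accumulate≡ (k * c) (Vec.map (k *_) cs) ρ | accumulate≡ c cs ρ | lin-* k cs ρ =
  sym (*-distribˡ-+ k c _)

⟦#⟧ : (c : ℕ) (ρ : Env n) → ⟦ # c ⟧ ρ ≡ c
⟦#⟧ c ρ = trans (accumulate≡ c (replicate _ 0) ρ) (trans (cong (c +_) (lin-zero ρ)) (+-identityʳ c))

⟦var⟧ : (v : Fin n) (ρ : Env n) → ⟦ var v ⟧ ρ ≡ lookup ρ v
⟦var⟧ v ρ = trans (accumulate≡ 0 (replicate _ 0 [ v ]≔ 1) ρ) (lin-unit v ρ)

⟦wk⟧ : (P : Form n) (k : ℕ) (ρ : Env n) → ⟦ wk P ⟧ (k ∷ ρ) ≡ ⟦ P ⟧ ρ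
⟦wk⟧ (affine c cs) k ρ = refl

⟦[≔]⟧ : (P : Form n) (v : Fin n) (E : Form n) (ρ : Env n) →
        ⟦ P [ v ≔ E ]ᶠ ⟧ ρ ≡ ⟦ P ⟧ (ρ [ v ]≔ ⟦ E ⟧ ρ)
⟦[≔]⟧ (affine c cs) v E ρ = begin
  ⟦ affine c (cs [ v ]≔ 0) ⊕ lookup cs v ⊛ E ⟧ ρ
    ≡⟨ ⟦⊕⟧ (affine c (cs [ v ]≔ 0)) (lookup cs v ⊛ E) ρ ⟩
  ⟦ affine c (cs [ v ]≔ 0) ⟧ ρ + ⟦ lookup cs v ⊛ E ⟧ ρ
    ≡⟨ cong₂ _+_ (accumulate≡ c (cs [ v ]≔ 0) ρ) (⟦⊛⟧ (lookup cs v) E ρ) ⟩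
  c + lin (cs [ v ]≔ 0) ρ + lookup cs v * ⟦ E ⟧ ρ
    ≡⟨ +-assoc c _ _ ⟩
  c + (lin (cs [ v ]≔ 0) ρ + lookup cs v * ⟦ E ⟧ ρ)
    ≡⟨ cong (c +_) (sym (lin-[]≔ cs ρ v (⟦ E ⟧ ρ))) ⟩
  c + lin cs (ρ [ v ]≔ ⟦ E ⟧ ρ)
    ≡⟨ sym (accumulate≡ c cs _) ⟩
  ⟦ affine c cs ⟧ (ρ [ v ]≔ ⟦ E ⟧ ρ) ∎
  where open ≡-Reasoning

_≤ᶠ_ _<ᶠ_ _≡ᶠ_ _≢ᶠ_ : Form n → Form n → Set
P ≤ᶠ Q = ∀ ρ → ⟦ P ⟧ ρ ≤ ⟦ Q ⟧ ρ
P <ᶠ Q = ∀ ρ → ⟦ P ⟧ ρ < ⟦ Q ⟧ ρ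
P ≡ᶠ Q = ∀ ρ → ⟦ P ⟧ ρ ≡ ⟦ Q ⟧ ρ
P ≢ᶠ Q = ∀ ρ → ⟦ P ⟧ ρ ≢ ⟦ Q ⟧ ρ

Difference : Form n → Form n → Set
Difference P Q = Σ (Form _) λ R → ∀ ρ → ⟦ Q ⟧ ρ ≡ ⟦ P ⟧ ρ + ⟦ R ⟧ ρ

-- Sound but incomplete: comparisons are established coefficientwise.
difference : (P Q : Form n) → Maybe (Difference P Q)
difference (affine c cs) (affine d ds) =
  Maybe.zipWith difference-from (dec⇒maybe (c ≤? d)) (dec⇒maybe (Pointwise.decidable _≤?_ cs ds))
  where
  difference-from : c ≤ d → Pointwise _≤_ cs ds → Difference (affine c cs) (affine d ds)
  difference-from c≤d cs≤ds = affine (d ∸ c) (Vec.zipWith _∸_ ds cs) , λ ρ → begin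
    ⟦ affine d ds ⟧ ρ
      ≡⟨ accumulate≡ d ds ρ ⟩
    d + lin ds ρ
      ≡⟨ cong₂ _+_ (sym (m+[n∸m]≡n c≤d)) (lin-∸ cs≤ds ρ) ⟩
    (c + (d ∸ c)) + (lin cs ρ + lin (Vec.zipWith _∸_ ds cs) ρ)
      ≡⟨ +-interchange c (d ∸ c) _ _ ⟩
    (c + lin cs ρ) + (d ∸ c + lin (Vec.zipWith _∸_ ds cs) ρ)
      ≡⟨ sym (cong₂ _+_ (accumulate≡ c cs ρ) (accumulate≡ (d ∸ c) (Vec.zipWith _∸_ ds cs) ρ)) ⟩
    ⟦ affine c cs ⟧ ρ + ⟦ affine (d ∸ c) (Vec.zipWith _∸_ ds cs) ⟧ ρ ∎
    where open ≡-Reasoning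

prove-≤ : (P Q : Form n) → Maybe (P ≤ᶠ Q)
prove-≤ P Q =
  Maybe.map (λ (R , Q≡P+R) ρ → subst (⟦ P ⟧ ρ ≤_) (sym (Q≡P+R ρ)) (m≤m+n _ _)) (difference P Q)

prove-< : (P Q : Form n) → Maybe (P <ᶠ Q)
prove-< P Q = Maybe.map (λ 1+P≤Q ρ → subst (_≤ ⟦ Q ⟧ ρ) (⟦+ᶠ⟧ 1 P ρ) (1+P≤Q ρ)) (prove-≤ (1 +ᶠ P) Q)

prove-≡ : (P Q : Form n) → Maybe (P ≡ᶠ Q)
prove-≡ P Q = Maybe.zipWith (λ P≤Q Q≤P ρ → ≤-antisym (P≤Q ρ) (Q≤P ρ)) (prove-≤ P Q) (prove-≤ Q P)

prove-≢ : (P Q : Form n) → Maybe (P ≢ᶠ Q)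
prove-≢ P Q = Maybe.map (λ P<Q ρ → <⇒≢ (P<Q ρ)) (prove-< P Q)
          <∣> Maybe.map (λ Q<P ρ → >⇒≢ (Q<P ρ)) (prove-< Q P)

prove-≡# : (y : Form n) (c : ℕ) → Maybe (∀ ρ → ⟦ y ⟧ ρ ≡ c)
prove-≡# y c = Maybe.map (λ y≡c ρ → trans (y≡c ρ) (⟦#⟧ c ρ)) (prove-≡ y (# c))

prove-#≤ : (c : ℕ) (y : Form n) → Maybe (∀ ρ → c ≤ ⟦ y ⟧ ρ)
prove-#≤ c y = Maybe.map (λ c≤y ρ → subst (_≤ ⟦ y ⟧ ρ) (⟦#⟧ c ρ) (c≤y ρ)) (prove-≤ (# c) y)

predecessor : (y : Form n) → Maybe (Σ (Form n) λ z → ∀ ρ → ⟦ y ⟧ ρ ≡ suc (⟦ z ⟧ ρ))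
predecessor (affine zero    cs) = nothing
predecessor (affine (suc c) cs) = just (affine c cs , ⟦+ᶠ⟧ 1 (affine c cs))

-- Symbolic evaluation of products of permutations

data Op (n : ℕ) : Set where
  cycᵒ cyc⁻¹ᵒ swapᵒ : Form n → Form n → Op n
  w0Jᵒ              : Form n → Op n

⟦_⟧ᵒ : Op n → Env n → Fun
⟦ cycᵒ i u ⟧ᵒ   ρ = cyc (⟦ i ⟧ ρ) (⟦ u ⟧ ρ)
⟦ cyc⁻¹ᵒ i u ⟧ᵒ ρ = cyc⁻¹ (⟦ i ⟧ ρ) (⟦ u ⟧ ρ)
⟦ swapᵒ a b ⟧ᵒ  ρ = swap (⟦ a ⟧ ρ) (⟦ b ⟧ ρ)
⟦ w0Jᵒ q ⟧ᵒ     ρ = w0J (⟦ q ⟧ ρ)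

run : List (Op n) → Env n → Fun
run []       ρ x = x
run (o ∷ os) ρ x = ⟦ o ⟧ᵒ ρ (run os ρ x)

Image : (Env n → Fun) → Form n → Set
Image f y = Σ (Form _) λ z → ∀ ρ → f ρ (⟦ y ⟧ ρ) ≡ ⟦ z ⟧ ρ

step : (o : Op n) (y : Form n) → Maybe (Image ⟦ o ⟧ᵒ y)
step (cycᵒ P Q) y = before <∣> inside <∣> top <∣> after <∣> trivial
  where
  before inside top after trivial : Maybe (Image ⟦ cycᵒ P Q ⟧ᵒ y)
  before  = Maybe.map (λ y<P → y , λ ρ → cyc-below {⟦ P ⟧ ρ} {⟦ Q ⟧ ρ} (y<P ρ)) (prove-< y P)
  inside  = Maybe.zipWith (λ P≤y y<Q → 1 +ᶠ y , λ ρ →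
              trans (cyc-inside {⟦ P ⟧ ρ} {⟦ Q ⟧ ρ} (P≤y ρ) (y<Q ρ)) (sym (⟦+ᶠ⟧ 1 y ρ)))
            (prove-≤ P y) (prove-< y Q)
  top     = Maybe.zipWith (λ y≡Q P<Q → P , λ ρ →
              trans (cong (cyc (⟦ P ⟧ ρ) (⟦ Q ⟧ ρ)) (y≡Q ρ)) (cyc-top {⟦ P ⟧ ρ} (P<Q ρ)))
            (prove-≡ y Q) (prove-< P Q)
  after   = Maybe.map (λ Q<y → y , λ ρ → cyc-above {⟦ P ⟧ ρ} {⟦ Q ⟧ ρ} (Q<y ρ)) (prove-< Q y)
  trivial = Maybe.map (λ Q≤P → y , λ ρ → cyc-trivial {⟦ P ⟧ ρ} {⟦ Q ⟧ ρ} (Q≤P ρ)) (prove-≤ Q P)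
step (cyc⁻¹ᵒ P Q) y = before <∣> bottom <∣> inside <∣> after <∣> trivial
  where
  before bottom inside after trivial : Maybe (Image ⟦ cyc⁻¹ᵒ P Q ⟧ᵒ y)
  before  = Maybe.map (λ y<P → y , λ ρ → cyc⁻¹-below {⟦ P ⟧ ρ} {⟦ Q ⟧ ρ} (y<P ρ)) (prove-< y P)
  bottom  = Maybe.zipWith (λ y≡P P<Q → Q , λ ρ →
              trans (cong (cyc⁻¹ (⟦ P ⟧ ρ) (⟦ Q ⟧ ρ)) (y≡P ρ)) (cyc⁻¹-bottom {⟦ P ⟧ ρ} (P<Q ρ)))
            (prove-≡ y P) (prove-< P Q)
  inside  = predecessor y >>= λ (z , y≡1+z) →
            Maybe.zipWith (λ P≤z z<Q → z , λ ρ →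
              trans (cong (cyc⁻¹ (⟦ P ⟧ ρ) (⟦ Q ⟧ ρ)) (y≡1+z ρ))
                    (cyc⁻¹-inside {⟦ P ⟧ ρ} {⟦ Q ⟧ ρ} (P≤z ρ) (z<Q ρ)))
            (prove-≤ P z) (prove-< z Q)
  after   = Maybe.map (λ Q<y → y , λ ρ → cyc⁻¹-above {⟦ P ⟧ ρ} {⟦ Q ⟧ ρ} (Q<y ρ)) (prove-< Q y)
  trivial = Maybe.map (λ Q≤P → y , λ ρ → cyc⁻¹-trivial {⟦ P ⟧ ρ} {⟦ Q ⟧ ρ} (Q≤P ρ)) (prove-≤ Q P)
step (swapᵒ A B) y = left <∣> right <∣> other
  where
  left right other : Maybe (Image ⟦ swapᵒ A B ⟧ᵒ y)
  left  = Maybe.map (λ y≡A → B , λ ρ →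
            trans (cong (swap (⟦ A ⟧ ρ) (⟦ B ⟧ ρ)) (y≡A ρ)) (swap-left {⟦ A ⟧ ρ}))
          (prove-≡ y A)
  right = Maybe.zipWith (λ y≡B A<B → A , λ ρ →
            trans (cong (swap (⟦ A ⟧ ρ) (⟦ B ⟧ ρ)) (y≡B ρ)) (swap-right {⟦ A ⟧ ρ} (>⇒≢ (A<B ρ))))
          (prove-≡ y B) (prove-< A B)
  other = Maybe.zipWith (λ y≢A y≢B → y , λ ρ → swap-other {⟦ A ⟧ ρ} {⟦ B ⟧ ρ} (y≢A ρ) (y≢B ρ))
          (prove-≢ y A) (prove-≢ y B)
step (w0Jᵒ Q) y =
  small 0 (λ _ → refl) <∣> small 1 (λ _ → refl) <∣> small 2 (λ _ → refl) <∣> middle <∣> after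
  where
  small : ∀ c {w} → (∀ q → w0J q c ≡ w) → Maybe (Image ⟦ w0Jᵒ Q ⟧ᵒ y)
  small c {w} w0Jc≡w = Maybe.map (λ y≡c → # w , λ ρ →
                         trans (cong (w0J (⟦ Q ⟧ ρ)) (y≡c ρ)) (trans (w0Jc≡w (⟦ Q ⟧ ρ)) (sym (⟦#⟧ w ρ))))
                       (prove-≡# y c)
  middle after : Maybe (Image ⟦ w0Jᵒ Q ⟧ᵒ y)
  middle = Maybe.zipWith (λ (3≤y , y≤Q) (z , 3+Q≡y+z) → z , λ ρ →
             w0J-middle {⟦ Q ⟧ ρ} (3≤y ρ) (y≤Q ρ) (trans (sym (3+Q≡y+z ρ)) (⟦+ᶠ⟧ 3 Q ρ)))
           (Maybe.zipWith _,_ (prove-#≤ 3 y) (prove-≤ y Q)) (difference y (3 +ᶠ Q))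
  after  = Maybe.zipWith (λ 3≤y Q<y → y , λ ρ → w0J-above {⟦ Q ⟧ ρ} (3≤y ρ) (Q<y ρ))
           (prove-#≤ 3 y) (prove-< Q y)

exec : (os : List (Op n)) (y : Form n) → Maybe (Image (run os) y)
exec []       y = just (y , λ _ → refl)
exec (o ∷ os) y = exec os y >>= λ (z , os↦z) →
  Maybe.map (λ (w , o↦w) → w , λ ρ → trans (cong (⟦ o ⟧ᵒ ρ) (os↦z ρ)) (o↦w ρ)) (step o z)

prove-<-images : (os : List (Op n)) (X Y : Form n) → Maybe (∀ ρ → run os ρ (⟦ X ⟧ ρ) < run os ρ (⟦ Y ⟧ ρ))
prove-<-images os X Y = exec os X >>= λ (z₁ , X↦z₁) → exec os Y >>= λ (z₂ , Y↦z₂) →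
  Maybe.map (λ z₁<z₂ ρ → subst₂ _<_ (sym (X↦z₁ ρ)) (sym (Y↦z₂ ρ)) (z₁<z₂ ρ)) (prove-< z₁ z₂)

mapᵒ : ∀ {m} → (Form n → Form m) → Op n → Op m
mapᵒ f (cycᵒ i u)   = cycᵒ (f i) (f u)
mapᵒ f (cyc⁻¹ᵒ i u) = cyc⁻¹ᵒ (f i) (f u)
mapᵒ f (swapᵒ a b)  = swapᵒ (f a) (f b)
mapᵒ f (w0Jᵒ q)     = w0Jᵒ (f q)

run-map : ∀ {m} (f : Form n → Form m) {ρ : Env n} {ρ′ : Env m} → (∀ P → ⟦ f P ⟧ ρ′ ≡ ⟦ P ⟧ ρ) →
          ∀ os x → run (List.map (mapᵒ f) os) ρ′ x ≡ run os ρ x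
run-map f               f-sound []       x = refl
run-map f {ρ} {ρ′} f-sound (o ∷ os) x =
  trans (map-sound o (run (List.map (mapᵒ f) os) ρ′ x)) (cong (⟦ o ⟧ᵒ ρ) (run-map f f-sound os x))
  where
  map-sound : ∀ o y → ⟦ mapᵒ f o ⟧ᵒ ρ′ y ≡ ⟦ o ⟧ᵒ ρ y
  map-sound (cycᵒ i u)   y = cong₂ (λ i u → cyc i u y) (f-sound i) (f-sound u)
  map-sound (cyc⁻¹ᵒ i u) y = cong₂ (λ i u → cyc⁻¹ i u y) (f-sound i) (f-sound u)
  map-sound (swapᵒ a b)  y = cong₂ (λ a b → swap a b y) (f-sound a) (f-sound b)
  map-sound (w0Jᵒ q)     y = cong (λ q → w0J q y) (f-sound q)

Agree : List (Op n) → List (Op n) → Env n → ℕ → Set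
Agree L R ρ x = run L ρ x ≡ run R ρ x

infix 4 _≈_

_≈_ : List (Op n) → List (Op n) → Set
L ≈ R = ∀ ρ x → Agree L R ρ x

AgreeAt : List (Op n) → List (Op n) → Form n → Set
AgreeAt L R X = ∀ ρ → Agree L R ρ (⟦ X ⟧ ρ)

AgreeFrom : List (Op n) → List (Op n) → Form n → Set
AgreeFrom L R lo = ∀ ρ k → Agree L R ρ (⟦ lo ⟧ ρ + k)

check-at : (L R : List (Op n)) (X : Form n) → Maybe (AgreeAt L R X)
check-at L R X = exec L X >>= λ (z₁ , L↦z₁) → exec R X >>= λ (z₂ , R↦z₂) →
  Maybe.map (λ z₁≡z₂ ρ → trans (L↦z₁ ρ) (trans (z₁≡z₂ ρ) (sym (R↦z₂ ρ)))) (prove-≡ z₁ z₂)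

agree-instance : ∀ {m} (f : Form n → Form m) {L R : List (Op n)} {ρ : Env n} {ρ′ : Env m} →
                 (∀ P → ⟦ f P ⟧ ρ′ ≡ ⟦ P ⟧ ρ) → ∀ {x′ x} → x′ ≡ x →
                 Agree (List.map (mapᵒ f) L) (List.map (mapᵒ f) R) ρ′ x′ → Agree L R ρ x
agree-instance f {L} {R} f-sound refl agree =
  trans (sym (run-map f f-sound L _)) (trans agree (run-map f f-sound R _))

[]≔-restore : (ρ : Env n) (v : Fin n) {t : ℕ} → lookup ρ v ≡ t → ρ [ v ]≔ t ≡ ρ
[]≔-restore ρ v refl = []≔-lookup ρ v

[]≔-overwrite : (ρ : Env n) (v : Fin n) {d t : ℕ} → lookup ρ v ≡ t → (ρ [ v ]≔ d) [ v ]≔ t ≡ ρ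
[]≔-overwrite ρ v ρv≡t = trans ([]≔-idempotent ρ v) ([]≔-restore ρ v ρv≡t)

-- A list of regions cuts ℕ into consecutive intervals starting at 0: point covers {lo},
-- below v covers [lo, lo + x_v), and the unbounded interval left after the last region is implicit.
-- On an interval the argument is lo + k, where k becomes a new leading parameter.
data Region (n : ℕ) : Set where
  point : Region n
  below : Fin n → Region n

extend : Form n → Form (suc n)
extend lo = wk lo ⊕ var zero

⟦extend⟧ : (lo : Form n) (k : ℕ) (ρ : Env n) → ⟦ extend lo ⟧ (k ∷ ρ) ≡ ⟦ lo ⟧ ρ + k
⟦extend⟧ lo k ρ = trans (⟦⊕⟧ (wk lo) (var zero) (k ∷ ρ)) (cong₂ _+_ (⟦wk⟧ lo k ρ) (⟦var⟧ zero (k ∷ ρ)))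

-- Below x_v the constraint k < x_v is built in by writing x_v = 1 + k + x_v′.
split : Fin n → Form (suc n) → Form (suc n)
split v P = P [ suc v ≔ 1 +ᶠ var zero ⊕ var (suc v) ]ᶠ

⟦split⟧ : (v : Fin n) (ρ : Env n) {k d : ℕ} → lookup ρ v ≡ suc (k + d) →
          (P : Form (suc n)) → ⟦ split v P ⟧ (k ∷ ρ [ v ]≔ d) ≡ ⟦ P ⟧ (k ∷ ρ)
⟦split⟧ v ρ {k} {d} ρv≡1+k+d P = begin
  ⟦ split v P ⟧ ρ′                              ≡⟨ ⟦[≔]⟧ P (suc v) E ρ′ ⟩
  ⟦ P ⟧ (k ∷ (ρ [ v ]≔ d) [ v ]≔ ⟦ E ⟧ ρ′)      ≡⟨ cong (λ t → ⟦ P ⟧ (k ∷ (ρ [ v ]≔ d) [ v ]≔ t)) ⟦E⟧≡1+k+d ⟩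
  ⟦ P ⟧ (k ∷ (ρ [ v ]≔ d) [ v ]≔ suc (k + d))   ≡⟨ cong (⟦ P ⟧ ∘ (k ∷_)) ([]≔-overwrite ρ v ρv≡1+k+d) ⟩
  ⟦ P ⟧ (k ∷ ρ)                                 ∎
  where
  open ≡-Reasoning
  ρ′ : Env (suc _)
  ρ′ = k ∷ ρ [ v ]≔ d
  E : Form (suc _)
  E = 1 +ᶠ var zero ⊕ var (suc v)
  ⟦E⟧≡1+k+d : ⟦ E ⟧ ρ′ ≡ suc (k + d)
  ⟦E⟧≡1+k+d = trans (⟦+ᶠ⟧ 1 (var zero ⊕ var (suc v)) ρ′) (cong suc (trans (⟦⊕⟧ (var zero) (var (suc v)) ρ′)
                (cong₂ _+_ (⟦var⟧ zero ρ′) (trans (⟦var⟧ (suc v) ρ′) (lookup∘update v ρ d)))))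

module _ {L R : List (Op n)} where

  agree-point : ∀ lo → AgreeAt L R lo → AgreeFrom L R (1 +ᶠ lo) → AgreeFrom L R lo
  agree-point lo at rest ρ zero    = subst (Agree L R ρ) (sym (+-identityʳ _)) (at ρ)
  agree-point lo at rest ρ (suc k) =
    subst (Agree L R ρ) (trans (cong (_+ k) (⟦+ᶠ⟧ 1 lo ρ)) (sym (+-suc _ k))) (rest ρ k)

  agree-below : ∀ lo v → AgreeAt (List.map (mapᵒ (split v ∘ wk)) L) (List.map (mapᵒ (split v ∘ wk)) R)
                                 (split v (extend lo)) →
                AgreeFrom L R (lo ⊕ var v) → AgreeFrom L R lo
  agree-below lo v at rest ρ k with k <? lookup ρ v
  ... | yes k<ρv = agree-instance (split v ∘ wk) {L} {R}
                     (λ P → trans (⟦split⟧ v ρ ρv≡1+k+d (wk P)) (⟦wk⟧ P k ρ))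
                     (trans (⟦split⟧ v ρ ρv≡1+k+d (extend lo)) (⟦extend⟧ lo k ρ)) (at (k ∷ ρ [ v ]≔ d))
    where
    d : ℕ
    d = lookup ρ v ∸ suc k
    ρv≡1+k+d : lookup ρ v ≡ suc (k + d)
    ρv≡1+k+d = sym (m+[n∸m]≡n k<ρv)
  ... | no k≮ρv = subst (Agree L R ρ) lo+v+k′≡lo+k (rest ρ (k ∸ lookup ρ v))
    where
    open ≡-Reasoning
    lo+v+k′≡lo+k : ⟦ lo ⊕ var v ⟧ ρ + (k ∸ lookup ρ v) ≡ ⟦ lo ⟧ ρ + k
    lo+v+k′≡lo+k = begin
      ⟦ lo ⊕ var v ⟧ ρ + (k ∸ lookup ρ v)
        ≡⟨ cong (_+ _) (trans (⟦⊕⟧ lo (var v) ρ) (cong (_ +_) (⟦var⟧ v ρ))) ⟩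
      ⟦ lo ⟧ ρ + lookup ρ v + (k ∸ lookup ρ v)
        ≡⟨ +-assoc (⟦ lo ⟧ ρ) _ _ ⟩
      ⟦ lo ⟧ ρ + (lookup ρ v + (k ∸ lookup ρ v))
        ≡⟨ cong (⟦ lo ⟧ ρ +_) (m+[n∸m]≡n (≮⇒≥ k≮ρv)) ⟩
      ⟦ lo ⟧ ρ + k ∎

  agree-tail : ∀ lo → AgreeAt (List.map (mapᵒ wk) L) (List.map (mapᵒ wk) R) (extend lo) → AgreeFrom L R lo
  agree-tail lo at ρ k = agree-instance wk {L} {R} (λ P → ⟦wk⟧ P k ρ) (⟦extend⟧ lo k ρ) (at (k ∷ ρ))

cover : (L R : List (Op n)) → List (Region n) → (lo : Form n) → Maybe (AgreeFrom L R lo)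
cover L R [] lo =
  Maybe.map (agree-tail {L = L} {R} lo) (check-at (List.map (mapᵒ wk) L) (List.map (mapᵒ wk) R) (extend lo))
cover L R (point ∷ rs) lo =
  Maybe.zipWith (agree-point {L = L} {R} lo) (check-at L R lo) (cover L R rs (1 +ᶠ lo))
cover L R (below v ∷ rs) lo =
  Maybe.zipWith (agree-below {L = L} {R} lo v)
    (check-at (List.map (mapᵒ (split v ∘ wk)) L) (List.map (mapᵒ (split v ∘ wk)) R) (split v (extend lo)))
    (cover L R rs (lo ⊕ var v))

by-cases : (v : Fin n) {L R : List (Op n)} →
           List.map (mapᵒ _[ v ≔ # 0 ]ᶠ) L ≈ List.map (mapᵒ _[ v ≔ # 0 ]ᶠ) R →
           List.map (mapᵒ _[ v ≔ 1 +ᶠ var v ]ᶠ) L ≈ List.map (mapᵒ _[ v ≔ 1 +ᶠ var v ]ᶠ) R →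
           L ≈ R
by-cases v {L} {R} zero-case suc-case ρ x with lookup ρ v in ρv≡
... | zero  = agree-instance _[ v ≔ # 0 ]ᶠ {L} {R}
                (λ P → trans (⟦[≔]⟧ P v (# 0) ρ) (cong ⟦ P ⟧ ([]≔-restore ρ v (trans ρv≡ (sym (⟦#⟧ 0 ρ))))))
                refl (zero-case ρ x)
... | suc d = agree-instance _[ v ≔ 1 +ᶠ var v ]ᶠ {L} {R}
                (λ P → trans (⟦[≔]⟧ P v (1 +ᶠ var v) (ρ [ v ]≔ d))
                             (cong ⟦ P ⟧ ([]≔-overwrite ρ v (trans ρv≡ (sym ⟦1+v⟧≡1+d)))))
                refl (suc-case (ρ [ v ]≔ d) x)
  where
  ⟦1+v⟧≡1+d : ⟦ 1 +ᶠ var v ⟧ (ρ [ v ]≔ d) ≡ suc d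
  ⟦1+v⟧≡1+d = trans (⟦+ᶠ⟧ 1 (var v) _) (cong suc (trans (⟦var⟧ v _) (lookup∘update v ρ d)))

data Plan (n : ℕ) : Set where
  regions : List (Region n) → Plan n
  cases   : Fin n → Plan n → Plan n → Plan n

prove-≈ : (L R : List (Op n)) → Plan n → Maybe (L ≈ R)
prove-≈ L R (regions rs) =
  Maybe.map (λ agree ρ x → subst (Agree L R ρ) (cong (_+ x) (⟦#⟧ 0 ρ)) (agree ρ x)) (cover L R rs (# 0))
prove-≈ L R (cases v p₀ p₁) =
  Maybe.zipWith (by-cases v {L} {R}) (prove-≈ (instantiate (# 0) L) (instantiate (# 0) R) p₀)
                                     (prove-≈ (instantiate (1 +ᶠ var v) L) (instantiate (1 +ᶠ var v) R) p₁)
  where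
  instantiate : Form _ → List (Op _) → List (Op _)
  instantiate E = List.map (mapᵒ _[ v ≔ E ]ᶠ)

-- Right multiplication by an increasing transposition

indicator : Bool → ℕ
indicator b = if b then 1 else 0

indicator-exchange : ∀ {s t} z → s < t →
  indicator (t <ᵇ z) + indicator (z <ᵇ s) ≤ indicator (z <ᵇ t) + indicator (s <ᵇ z)
indicator-exchange {s} {t} z s<t with t <ᵇ z in t<ᵇz | z <ᵇ s in z<ᵇs
... | true  | true  = ⊥-elim (<-asym (<-trans (<ᵇ-true⇒< t z t<ᵇz) (<ᵇ-true⇒< z s z<ᵇs)) s<t)
... | true  | false rewrite <ᵇ-true (<-trans s<t (<ᵇ-true⇒< t z t<ᵇz)) = m≤n+m 1 _
... | false | true  rewrite <ᵇ-true (<-trans (<ᵇ-true⇒< z s z<ᵇs) s<t) = s≤s z≤n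
... | false | false = z≤n

+-exchange : ∀ x p q → x + p + q ≡ x + q + p
+-exchange = solve-∀

-- Inversions of σ and τ = σ (a b) are compared among the first n positions, n = 0, 1, …, q:
-- they agree before a, τ catches up from a to b, and they agree again after b.
module Transposition (σ τ : Fun) (a₀ b₀ : ℕ) (a<b : a₀ < b₀)
                     (τ≗σ∘swap : ∀ x → τ x ≡ σ (swap (suc a₀) (suc b₀) x))
                     (σa<σb : σ (suc a₀) < σ (suc b₀)) where

  a b : ℕ
  a = suc a₀
  b = suc b₀

  τa≡σb : τ a ≡ σ b
  τa≡σb = trans (τ≗σ∘swap a) (cong σ (swap-left {a}))

  τb≡σa : τ b ≡ σ a
  τb≡σa = trans (τ≗σ∘swap b) (cong σ (swap-right {a} (>⇒≢ (s≤s a<b))))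

  τ≡σ-before : ∀ {x} → x < a → τ x ≡ σ x
  τ≡σ-before x<a = trans (τ≗σ∘swap _) (cong σ (swap-other (<⇒≢ x<a) (<⇒≢ (<-trans x<a (s≤s a<b)))))

  τ≡σ-between : ∀ {x} → a < x → x < b → τ x ≡ σ x
  τ≡σ-between a<x x<b = trans (τ≗σ∘swap _) (cong σ (swap-other (>⇒≢ a<x) (<⇒≢ x<b)))

  τ≡σ-after : ∀ {x} → b < x → τ x ≡ σ x
  τ≡σ-after b<x = trans (τ≗σ∘swap _) (cong σ (swap-other (>⇒≢ (<-trans (s≤s a<b) b<x)) (>⇒≢ b<x)))

  above-before : ∀ {n} → n < a → ∀ y → above τ y n ≡ above σ y n
  above-before {zero}  _     y = refl
  above-before {suc n} 1+n<a y =
    cong₂ _+_ (above-before (<-trans (n<1+n n) 1+n<a) y) (cong (indicator ∘ (y <ᵇ_)) (τ≡σ-before 1+n<a))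

  len-before : ∀ {n} → n < a → len τ n ≡ len σ n
  len-before {zero}  _     = refl
  len-before {suc n} 1+n<a = cong₂ _+_ (len-before n<a)
    (trans (cong (λ z → above τ z n) (τ≡σ-before 1+n<a)) (above-before n<a _))
    where
    n<a : n < a
    n<a = <-trans (n<1+n n) 1+n<a

  above-between : ∀ {n} → a ≤′ n → n < b → ∀ y →
                  above τ y n + indicator (y <ᵇ σ a) ≡ above σ y n + indicator (y <ᵇ σ b)
  above-between ≤′-refl _ y rewrite above-before (n<1+n a₀) y | τa≡σb =
    +-exchange (above σ y a₀) (indicator (y <ᵇ σ b)) (indicator (y <ᵇ σ a))
  above-between {suc n} (≤′-step a≤n) 1+n<b y rewrite τ≡σ-between (s≤s (≤′⇒≤ a≤n)) 1+n<b =
    trans (+-exchange (above τ y n) _ _)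
          (trans (cong (_+ indicator (y <ᵇ σ (suc n))) (above-between a≤n (<-trans (n<1+n n) 1+n<b) y))
                 (+-exchange (above σ y n) _ _))

  len-between : ∀ {n} → a ≤′ n → n < b → len σ n + above σ (σ b) n ≤ len τ n + above τ (σ a) n
  len-between ≤′-refl _
    rewrite len-before (n<1+n a₀) | τa≡σb | above-before (n<1+n a₀) (σ b) | above-before (n<1+n a₀) (σ a)
          | <ᵇ-false (<⇒≤ σa<σb) | <ᵇ-true σa<σb =
    ≤-trans (n≤1+n _) (≤-reflexive (shuffle (len σ a₀) (above σ (σ a) a₀) (above σ (σ b) a₀)))
    where
    shuffle : ∀ L A B → suc (L + A + (B + 0)) ≡ L + B + (A + 1)
    shuffle = solve-∀
  len-between {suc n} (≤′-step a≤n) 1+n<b rewrite τ≡σ-between (s≤s (≤′⇒≤ a≤n)) 1+n<b =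
    +-cancelʳ-≤ [z<σa] _ _ (begin
      len σ n + Aσ + (Bσ + [σb<z]) + [z<σa]    ≡⟨ shuffle₁ (len σ n) Aσ Bσ [σb<z] [z<σa] ⟩
      (len σ n + Bσ) + Aσ + ([σb<z] + [z<σa])  ≤⟨ +-mono-≤ (+-monoˡ-≤ Aσ (len-between a≤n n<b))
                                                            (indicator-exchange z σa<σb) ⟩
      (len τ n + Bτ) + Aσ + ([z<σb] + [σa<z])  ≡⟨ shuffle₂ (len τ n + Bτ) Aσ [z<σb] [σa<z] ⟩
      (len τ n + Bτ) + (Aσ + [z<σb]) + [σa<z]  ≡⟨ cong (λ t → len τ n + Bτ + t + [σa<z])
                                                       (sym (above-between a≤n n<b z)) ⟩
      (len τ n + Bτ) + (Aτ + [z<σa]) + [σa<z]  ≡⟨ shuffle₃ (len τ n) Bτ Aτ [z<σa] [σa<z] ⟩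
      len τ n + Aτ + (Bτ + [σa<z]) + [z<σa]    ∎)
    where
    open ≤-Reasoning
    n<b : n < b
    n<b = <-trans (n<1+n n) 1+n<b
    z Aσ Aτ Bσ Bτ [z<σa] [z<σb] [σa<z] [σb<z] : ℕ
    z = σ (suc n)
    Aσ = above σ z n
    Aτ = above τ z n
    Bσ = above σ (σ b) n
    Bτ = above τ (σ a) n
    [z<σa] = indicator (z <ᵇ σ a)
    [z<σb] = indicator (z <ᵇ σ b)
    [σa<z] = indicator (σ a <ᵇ z)
    [σb<z] = indicator (σ b <ᵇ z)
    shuffle₁ : ∀ L A B e c → L + A + (B + e) + c ≡ (L + B) + A + (e + c)
    shuffle₁ = solve-∀
    shuffle₂ : ∀ X A d f → X + A + (d + f) ≡ X + (A + d) + f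
    shuffle₂ = solve-∀
    shuffle₃ : ∀ L B A c f → (L + B) + (A + c) + f ≡ L + A + (B + f) + c
    shuffle₃ = solve-∀

  above-after : ∀ {n} → b ≤′ n → ∀ y → above τ y n ≡ above σ y n
  above-after ≤′-refl y rewrite τb≡σa = above-between (≤⇒≤′ a<b) (n<1+n b₀) y
  above-after {suc n} (≤′-step b≤n) y =
    cong₂ _+_ (above-after b≤n y) (cong (indicator ∘ (y <ᵇ_)) (τ≡σ-after (s≤s (≤′⇒≤ b≤n))))

  len-after : ∀ {n} → b ≤′ n → len σ n ≤ len τ n
  len-after ≤′-refl rewrite τb≡σa = len-between (≤⇒≤′ a<b) (n<1+n b₀)
  len-after {suc n} (≤′-step b≤n) = +-mono-≤ (len-after b≤n) (≤-reflexive (sym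
    (trans (cong (λ z → above τ z n) (τ≡σ-after (s≤s (≤′⇒≤ b≤n)))) (above-after b≤n _))))

len-∘swap : ∀ {q σ τ a b} → 1 ≤ a → a < b → b ≤ q → (∀ x → τ x ≡ σ (swap a b x)) → σ a < σ b →
            len σ q ≤ len τ q
len-∘swap {σ = σ} {τ} {suc a₀} {suc b₀} _ (s≤s a<b) b≤q τ≗σ∘swap σa<σb =
  Transposition.len-after σ τ a₀ b₀ a<b τ≗σ∘swap σa<σb (≤⇒≤′ b≤q)

Bruhat-∘swap : ∀ {q v w} a b → 1 ≤ a → a < b → b ≤ q → (∀ x → w x ≡ v (swap a b x)) → v a < v b →
               Bruhat q v w
Bruhat-∘swap a b 1≤a a<b b≤q w≗v∘swap va<vb =
  chain-step a b 1≤a a<b b≤q w≗v∘swap (len-∘swap 1≤a a<b b≤q w≗v∘swap va<vb) (chain-base (λ _ → refl))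

-- Cycles on {3,…,q} lie in W_J

by-cycle-length : (P : ℕ → ℕ → Set) → (∀ {i u} → u ≤ i → P i u) → (∀ i d → P i (i + d)) → ∀ i u → P i u
by-cycle-length P trivial extended i u with ≤-total u i
... | inj₁ u≤i = trivial u≤i
... | inj₂ i≤u with m≤n⇒∃[o]m+o≡n i≤u
...   | d , refl = extended i d

module CycleIdentities where
  #i #d : Fin 2
  #i = zero
  #d = suc zero

  i d : Form 2
  i = var #i
  d = var #d

  cyc-extend : ∀ i d x → cyc i (suc (i + d)) x ≡ cyc i (i + d) (swap (i + d) (suc (i + d)) x)
  cyc-extend i′ d′ = from-just
    (prove-≈ (cycᵒ i (1 +ᶠ i ⊕ d) ∷ []) (cycᵒ i (i ⊕ d) ∷ swapᵒ (i ⊕ d) (1 +ᶠ i ⊕ d) ∷ [])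
             (cases #d (regions (below #i ∷ point ∷ point ∷ []))
                       (regions (below #i ∷ point ∷ below #d ∷ point ∷ point ∷ []))))
    (i′ ∷ d′ ∷ [])

  cyc⁻¹-extend : ∀ i d x → cyc⁻¹ i (suc (i + d)) x ≡ cyc⁻¹ (suc i) (suc (i + d)) (swap i (suc i) x)
  cyc⁻¹-extend i′ d′ = from-just
    (prove-≈ (cyc⁻¹ᵒ i (1 +ᶠ i ⊕ d) ∷ []) (cyc⁻¹ᵒ (1 +ᶠ i) (1 +ᶠ i ⊕ d) ∷ swapᵒ i (1 +ᶠ i) ∷ [])
             (cases #d (regions (below #i ∷ point ∷ point ∷ []))
                       (regions (below #i ∷ point ∷ point ∷ below #d ∷ point ∷ []))))
    (i′ ∷ d′ ∷ [])

  cyc∘cyc⁻¹ : ∀ i u x → cyc i u (cyc⁻¹ i u x) ≡ x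
  cyc∘cyc⁻¹ = by-cycle-length (λ i u → ∀ x → cyc i u (cyc⁻¹ i u x) ≡ x)
    (λ u≤i x → trans (cyc-trivial u≤i) (cyc⁻¹-trivial u≤i))
    (λ i′ d′ → from-just
      (prove-≈ (cycᵒ i (i ⊕ d) ∷ cyc⁻¹ᵒ i (i ⊕ d) ∷ []) []
               (cases #d (regions []) (regions (below #i ∷ point ∷ below #d ∷ point ∷ []))))
      (i′ ∷ d′ ∷ []))

  cyc⁻¹∘cyc : ∀ i u x → cyc⁻¹ i u (cyc i u x) ≡ x
  cyc⁻¹∘cyc = by-cycle-length (λ i u → ∀ x → cyc⁻¹ i u (cyc i u x) ≡ x)
    (λ u≤i x → trans (cyc⁻¹-trivial u≤i) (cyc-trivial u≤i))
    (λ i′ d′ → from-just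
      (prove-≈ (cyc⁻¹ᵒ i (i ⊕ d) ∷ cycᵒ i (i ⊕ d) ∷ []) []
               (cases #d (regions []) (regions (below #i ∷ point ∷ below #d ∷ point ∷ []))))
      (i′ ∷ d′ ∷ []))

open CycleIdentities using (cyc-extend; cyc⁻¹-extend; cyc∘cyc⁻¹; cyc⁻¹∘cyc)

InWJ-resp : ∀ {q g h} → InWJ q g → g ≗ h → InWJ q h
InWJ-resp (wj-id g≗id)                 g≗h = wj-id (λ x → trans (sym (g≗h x)) (g≗id x))
InWJ-resp (wj-step i 1≤i i<q i≢2 g≗ w) g≗h = wj-step i 1≤i i<q i≢2 (λ x → trans (sym (g≗h x)) (g≗ x)) w

InWJ-∘ : ∀ {q g h} → InWJ q g → InWJ q h → InWJ q (λ x → g (h x))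
InWJ-∘ {g = g} g∈WJ (wj-id h≗id)                 = InWJ-resp g∈WJ (λ x → cong g (sym (h≗id x)))
InWJ-∘ {g = g} g∈WJ (wj-step i 1≤i i<q i≢2 h≗ w) = wj-step i 1≤i i<q i≢2 (λ x → cong g (h≗ x)) (InWJ-∘ g∈WJ w)

3≤⇒≢2 : ∀ {n} → 3 ≤ n → n ≢ 2
3≤⇒≢2 (s≤s (s≤s (s≤s _))) ()

cyc∈WJ : ∀ {q} i u → 3 ≤ i → u ≤ q → InWJ q (cyc i u)
cyc∈WJ {q} = by-cycle-length (λ i u → 3 ≤ i → u ≤ q → InWJ q (cyc i u))
  (λ u≤i _ _ → wj-id (λ x → cyc-trivial u≤i)) (λ i d → from d)
  where
  from : ∀ d {i} → 3 ≤ i → i + d ≤ q → InWJ q (cyc i (i + d))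
  from zero    {i} _   _ = wj-id (λ x → cyc-trivial (≤-reflexive (+-identityʳ i)))
  from (suc d) {i} 3≤i i+1+d≤q rewrite +-suc i d =
    wj-step (i + d) (≤-trans (s≤s z≤n) 3≤i+d) i+1+d≤q (3≤⇒≢2 3≤i+d) (cyc-extend i d)
            (from d 3≤i (<⇒≤ i+1+d≤q))
    where
    3≤i+d : 3 ≤ i + d
    3≤i+d = ≤-trans 3≤i (m≤m+n i d)

cyc⁻¹∈WJ : ∀ {q} i u → 3 ≤ i → u ≤ q → InWJ q (cyc⁻¹ i u)
cyc⁻¹∈WJ {q} = by-cycle-length (λ i u → 3 ≤ i → u ≤ q → InWJ q (cyc⁻¹ i u))
  (λ u≤i _ _ → wj-id (λ x → cyc⁻¹-trivial u≤i)) (λ i d → from d)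
  where
  from : ∀ d {i} → 3 ≤ i → i + d ≤ q → InWJ q (cyc⁻¹ i (i + d))
  from zero    {i} _   _ = wj-id (λ x → cyc⁻¹-trivial (≤-reflexive (+-identityʳ i)))
  from (suc d) {i} 3≤i i+1+d≤q rewrite +-suc i d =
    wj-step i (≤-trans (s≤s z≤n) 3≤i) (≤-trans (s≤s (m≤m+n i d)) i+1+d≤q) (3≤⇒≢2 3≤i) (cyc⁻¹-extend i d)
            (from d (≤-trans 3≤i (n≤1+n i)) i+1+d≤q)

closure-by-transposition : ∀ {q w w′ h h⁻¹} a b → InWJ q h → (∀ x → h (h⁻¹ x) ≡ x) → (∀ x → h⁻¹ (h x) ≡ x) →
  1 ≤ a → a < b → b ≤ q → (∀ x → h (w (w0J q (h⁻¹ (w0J q (swap a b x))))) ≡ w′ x) → w′ b < w′ a →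
  Closure q w w′
closure-by-transposition {q} {w} {w′} {h} {h⁻¹} a b h∈WJ hh⁻¹ h⁻¹h 1≤a a<b b≤q e∘swap≗w′ w′b<w′a =
  h , h⁻¹ , h∈WJ , hh⁻¹ , h⁻¹h , Bruhat-∘swap a b 1≤a a<b b≤q (λ x → sym (e∘swap≗w′ x)) ea<eb
  where
  e : Fun
  e x = h (w (w0J q (h⁻¹ (w0J q x))))
  ea<eb : e a < e b
  ea<eb = subst₂ _<_ (trans (sym (e∘swap≗w′ b)) (cong e (swap-right {a} (>⇒≢ a<b))))
                     (trans (sym (e∘swap≗w′ a)) (cong e (swap-left {a})))
                     w′b<w′a

data Rotation (n : ℕ) : Set where
  forward backward : Form n → Form n → Rotation n

rotationᵒ : Rotation n → Op n
rotationᵒ (forward  i u) = cycᵒ i u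
rotationᵒ (backward i u) = cyc⁻¹ᵒ i u

inverse : Rotation n → Rotation n
inverse (forward  i u) = backward i u
inverse (backward i u) = forward i u

⟦_⟧ʳ : Rotation n → Env n → Fun
⟦ r ⟧ʳ = ⟦ rotationᵒ r ⟧ᵒ

rotation∘inverse : ∀ (r : Rotation n) ρ x → ⟦ r ⟧ʳ ρ (⟦ inverse r ⟧ʳ ρ x) ≡ x
rotation∘inverse (forward  i u) ρ = cyc∘cyc⁻¹ (⟦ i ⟧ ρ) (⟦ u ⟧ ρ)
rotation∘inverse (backward i u) ρ = cyc⁻¹∘cyc (⟦ i ⟧ ρ) (⟦ u ⟧ ρ)

inverse∘rotation : ∀ (r : Rotation n) ρ x → ⟦ inverse r ⟧ʳ ρ (⟦ r ⟧ʳ ρ x) ≡ x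
inverse∘rotation (forward  i u) ρ = cyc⁻¹∘cyc (⟦ i ⟧ ρ) (⟦ u ⟧ ρ)
inverse∘rotation (backward i u) ρ = cyc∘cyc⁻¹ (⟦ i ⟧ ρ) (⟦ u ⟧ ρ)

prove-∈WJ : (q : Form n) (r : Rotation n) → Maybe (∀ ρ → InWJ (⟦ q ⟧ ρ) (⟦ r ⟧ʳ ρ))
prove-∈WJ q (forward i u) =
  Maybe.zipWith (λ 3≤i u≤q ρ → cyc∈WJ _ _ (3≤i ρ) (u≤q ρ)) (prove-#≤ 3 i) (prove-≤ u q)
prove-∈WJ q (backward i u) =
  Maybe.zipWith (λ 3≤i u≤q ρ → cyc⁻¹∈WJ _ _ (3≤i ρ) (u≤q ρ)) (prove-#≤ 3 i) (prove-≤ u q)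

γᵒ : Form n → Form n → List (Op n)
γᵒ u v = cycᵒ (# 2) v ∷ cycᵒ (# 1) u ∷ []

run-γᵒ : ∀ (u v : Form n) ρ x → run (γᵒ u v) ρ x ≡ γ (⟦ u ⟧ ρ) (⟦ v ⟧ ρ) x
run-γᵒ u v ρ x rewrite ⟦#⟧ 1 ρ | ⟦#⟧ 2 ρ = refl

-- A certificate describes h = r₁ r₂ ∈ W_J and t = (a b) such that h γ_{u,v} w₀ h⁻¹ w₀ t = γ_{u′,v′}
-- in 𝔖_q, the identity to be verified along plan.
record Certificate (n : ℕ) : Set where
  field
    q u v u′ v′ a b : Form n
    r₁ r₂           : Rotation n
    plan            : Plan n

  conjugateᵒ : List (Op n)
  conjugateᵒ = rotationᵒ r₁ ∷ rotationᵒ r₂ ∷ γᵒ u v ++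
               w0Jᵒ q ∷ rotationᵒ (inverse r₂) ∷ rotationᵒ (inverse r₁) ∷ w0Jᵒ q ∷ swapᵒ a b ∷ []

check-certificate : (c : Certificate n) → let open Certificate c in
  Maybe (∀ ρ → Closure (⟦ q ⟧ ρ) (γ (⟦ u ⟧ ρ) (⟦ v ⟧ ρ)) (γ (⟦ u′ ⟧ ρ) (⟦ v′ ⟧ ρ)))
check-certificate c = do
    r₁∈WJ      ← prove-∈WJ q r₁
    r₂∈WJ      ← prove-∈WJ q r₂
    1≤a        ← prove-#≤ 1 a
    a<b        ← prove-< a b
    b≤q        ← prove-≤ b q
    conjugate≈ ← prove-≈ conjugateᵒ (γᵒ u′ v′) plan
    descent    ← prove-<-images (γᵒ u′ v′) b a
    just λ ρ → closure-by-transposition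
      {w = γ (⟦ u ⟧ ρ) (⟦ v ⟧ ρ)} {w′ = γ (⟦ u′ ⟧ ρ) (⟦ v′ ⟧ ρ)}
      {h = λ x → ⟦ r₁ ⟧ʳ ρ (⟦ r₂ ⟧ʳ ρ x)} {h⁻¹ = λ x → ⟦ inverse r₂ ⟧ʳ ρ (⟦ inverse r₁ ⟧ʳ ρ x)}
      (⟦ a ⟧ ρ) (⟦ b ⟧ ρ)
      (InWJ-∘ (r₁∈WJ ρ) (r₂∈WJ ρ))
      (λ x → trans (cong (⟦ r₁ ⟧ʳ ρ) (rotation∘inverse r₂ ρ _)) (rotation∘inverse r₁ ρ x))
      (λ x → trans (cong (⟦ inverse r₂ ⟧ʳ ρ) (inverse∘rotation r₁ ρ _)) (inverse∘rotation r₂ ρ x))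
      (1≤a ρ) (a<b ρ) (b≤q ρ)
      (λ x → trans (cong (λ y → ⟦ r₁ ⟧ʳ ρ (⟦ r₂ ⟧ʳ ρ y)) (sym (run-γᵒ u v ρ _)))
                   (trans (conjugate≈ ρ x) (run-γᵒ u′ v′ ρ x)))
      (subst₂ _<_ (run-γᵒ u′ v′ ρ _) (run-γᵒ u′ v′ ρ _) (descent ρ))
  where open Certificate c

module Family₁ where
  #m #i₀ #g : Fin 3
  #m  = zero
  #i₀ = suc zero
  #g  = suc (suc zero)

  m i₀ g i j q q-j j-i : Form 3
  m   = var #m
  i₀  = var #i₀
  g   = var #g
  i   = 1 +ᶠ i₀
  j   = 4 +ᶠ m ⊕ i₀
  q   = 1 +ᶠ 2 ⊛ j ⊕ g
  q-j = 1 +ᶠ j ⊕ g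
  j-i = 3 +ᶠ m

  certificate : Certificate 3
  certificate = record
    { q  = q ; u  = 1 +ᶠ j ; v  = 1 +ᶠ q-j ⊕ i ; u′ = j ; v′ = 3 +ᶠ q-j ⊕ i
    ; a  = 1 +ᶠ q-j ; b = 3 +ᶠ q-j ⊕ i
    ; r₁ = backward (2 +ᶠ j-i) (2 +ᶠ j) ; r₂ = forward (2 +ᶠ q-j) (3 +ᶠ q-j ⊕ i)
    ; plan = regions (point ∷ point ∷ point ∷ below #m ∷ point ∷ below #i₀ ∷ point ∷ point ∷ below #g ∷
                      point ∷ point ∷ below #i₀ ∷ point ∷ point ∷ below #m ∷ [])
    }

module Family₂ where
  #k #i₀ #g : Fin 3
  #k  = zero
  #i₀ = suc zero
  #g  = suc (suc zero)

  k i₀ g i j q q-j j-i : Form 3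
  k   = var #k
  i₀  = var #i₀
  g   = var #g
  i   = 1 +ᶠ i₀
  j   = 6 +ᶠ k ⊕ 2 ⊛ i₀ ⊕ g
  q   = 1 +ᶠ j ⊕ k
  q-j = 1 +ᶠ k
  j-i = 5 +ᶠ k ⊕ i₀ ⊕ g

  certificate : Certificate 3
  certificate = record
    { q  = q ; u  = q-j ; v  = 1 +ᶠ j-i ; u′ = 2 +ᶠ q-j ; v′ = j-i
    ; a  = q-j ; b = 2 +ᶠ q-j
    ; r₁ = forward (2 +ᶠ q-j) (3 +ᶠ q-j ⊕ i) ; r₂ = backward (1 +ᶠ j-i) (1 +ᶠ j)
    ; plan = cases #k
        (regions (point ∷ point ∷ point ∷ point ∷ point ∷ below #i₀ ∷ below #g ∷ point ∷ point ∷
                  below #i₀ ∷ point ∷ []))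
        (cases #k
          (regions (point ∷ point ∷ point ∷ point ∷ point ∷ point ∷ below #i₀ ∷ below #g ∷ point ∷ point ∷
                    below #i₀ ∷ point ∷ point ∷ []))
          (regions (point ∷ point ∷ point ∷ below #k ∷ point ∷ point ∷ point ∷ point ∷ below #i₀ ∷ below #g ∷
                    point ∷ point ∷ below #i₀ ∷ point ∷ point ∷ point ∷ below #k ∷ [])))
    }

γ-closure-cong : ∀ {q q′ u u′ v v′ s s′ t t′} → q ≡ q′ → u ≡ u′ → v ≡ v′ → s ≡ s′ → t ≡ t′ →
                 Closure q (γ u v) (γ s t) → Closure q′ (γ u′ v′) (γ s′ t′)
γ-closure-cong refl refl refl refl refl c = c

m≡n+o⇒n≡m∸o : ∀ {m n o} → m ≡ n + o → n ≡ m ∸ o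
m≡n+o⇒n≡m∸o {n = n} {o} refl = sym (m+n∸n≡m n o)

closure₁ : ∀ m i₀ g → let i = suc i₀; j = i + 3 + m; q = suc (2 * j) + g in
           Closure q (γ (j + 1) ((q + 1 + i) ∸ j)) (γ j ((q + 3 + i) ∸ j))
closure₁ m i₀ g =
  γ-closure-cong (q≡ m i₀ g) (u≡ m i₀) (m≡n+o⇒n≡m∸o (v≡ m i₀ g)) (u′≡ m i₀) (m≡n+o⇒n≡m∸o (v′≡ m i₀ g))
    (from-just (check-certificate Family₁.certificate) (m ∷ i₀ ∷ g ∷ []))
  where
  q≡ : ∀ m i₀ g → 9 + m + m + i₀ + i₀ + g ≡ suc (2 * (suc i₀ + 3 + m)) + g
  q≡ = solve-∀
  u≡ : ∀ m i₀ → 5 + m + i₀ ≡ suc i₀ + 3 + m + 1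
  u≡ = solve-∀
  v≡ : ∀ m i₀ g → suc (2 * (suc i₀ + 3 + m)) + g + 1 + suc i₀ ≡ 7 + m + i₀ + i₀ + g + (suc i₀ + 3 + m)
  v≡ = solve-∀
  u′≡ : ∀ m i₀ → 4 + m + i₀ ≡ suc i₀ + 3 + m
  u′≡ = solve-∀
  v′≡ : ∀ m i₀ g → suc (2 * (suc i₀ + 3 + m)) + g + 3 + suc i₀ ≡ 9 + m + i₀ + i₀ + g + (suc i₀ + 3 + m)
  v′≡ = solve-∀

closure₂ : ∀ k i₀ g → let i = suc i₀; j = 6 + k + i₀ + i₀ + g; q = j + 1 + k in
           Closure q (γ (q ∸ j) ((j + 1) ∸ i)) (γ ((q + 2) ∸ j) (j ∸ i))
closure₂ k i₀ g =
  γ-closure-cong (q≡ k i₀ g) (m≡n+o⇒n≡m∸o (u≡ k i₀ g)) (m≡n+o⇒n≡m∸o (v≡ k i₀ g))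
                 (m≡n+o⇒n≡m∸o (u′≡ k i₀ g)) (m≡n+o⇒n≡m∸o (v′≡ k i₀ g))
    (from-just (check-certificate Family₂.certificate) (k ∷ i₀ ∷ g ∷ []))
  where
  q≡ : ∀ k i₀ g → 7 + k + k + i₀ + i₀ + g ≡ 6 + k + i₀ + i₀ + g + 1 + k
  q≡ = solve-∀
  u≡ : ∀ k i₀ g → 6 + k + i₀ + i₀ + g + 1 + k ≡ 1 + k + (6 + k + i₀ + i₀ + g)
  u≡ = solve-∀
  v≡ : ∀ k i₀ g → 6 + k + i₀ + i₀ + g + 1 ≡ 6 + k + i₀ + g + suc i₀
  v≡ = solve-∀
  u′≡ : ∀ k i₀ g → 6 + k + i₀ + i₀ + g + 1 + k + 2 ≡ 3 + k + (6 + k + i₀ + i₀ + g)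
  u′≡ = solve-∀
  v′≡ : ∀ k i₀ g → 6 + k + i₀ + i₀ + g ≡ 5 + k + i₀ + g + suc i₀
  v′≡ = solve-∀

j-from-slack : ∀ j k i₀ g → suc (2 * suc i₀ + (j + 1 + k) + 2) + g ≡ 2 * j → 6 + k + i₀ + i₀ + g ≡ j
j-from-slack j k i₀ g eq = +-cancelˡ-≡ j _ _ (trans (shuffle j k i₀ g) (trans eq (twice j)))
  where
  shuffle : ∀ j k i₀ g → j + (6 + k + i₀ + i₀ + g) ≡ suc (2 * suc i₀ + (j + 1 + k) + 2) + g
  shuffle = solve-∀
  twice : ∀ j → 2 * j ≡ j + j
  twice = solve-∀

part₁ : ∀ q j i → 2 * j < q → 1 ≤ i → i + 3 ≤ j →
        Closure q (γ (j + 1) ((q + 1 + i) ∸ j)) (γ j ((q + 3 + i) ∸ j))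
part₁ q j (suc i₀) 2j<q _ i+3≤j with m≤n⇒∃[o]m+o≡n i+3≤j
... | m , refl with m≤n⇒∃[o]m+o≡n 2j<q
...   | g , refl = closure₁ m i₀ g

part₂ : ∀ q j i → j + 1 ≤ q → 1 ≤ i → 2 * i + q + 2 < 2 * j →
        Closure q (γ (q ∸ j) ((j + 1) ∸ i)) (γ ((q + 2) ∸ j) (j ∸ i))
part₂ q j (suc i₀) j+1≤q _ 2i+q+2<2j with m≤n⇒∃[o]m+o≡n j+1≤q
... | k , refl with m≤n⇒∃[o]m+o≡n 2i+q+2<2j
...   | g , 2i+q+3+g≡2j with j-from-slack j k i₀ g 2i+q+3+g≡2j
...     | refl = closure₂ k i₀ g

theorem3p17 : (q : ℕ) → 7 ≤ q →
    ((j i : ℕ) → 4 ≤ j → 2 * j < q → 1 ≤ i → i + 3 ≤ j →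
      Closure q (γ (j + 1) ((q + 1 + i) ∸ j)) (γ j ((q + 3 + i) ∸ j)))
    × ((j i : ℕ) → q + 4 < 2 * j → j + 1 ≤ q → 1 ≤ i → 2 * i + q + 2 < 2 * j →
      Closure q (γ (q ∸ j) ((j + 1) ∸ i)) (γ ((q + 2) ∸ j) (j ∸ i)))
theorem3p17 q _ = (λ j i _ → part₁ q j i) , (λ j i _ → part₂ q j i)
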